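{- (Soundness) For every set $\Gamma$ of formulae of $\mathcal{L}_{\succ}$ and every formula $\phi$ of $\mathcal{L}_{\succ}$: if $\Gamma \vdash_{\mathbf{LCR}} \phi$, then $\Gamma \models_{\mathcal{C}_K^{\mathbf{LCR}}} \phi$.
   Context: Fix an integer $m\ge 2$ and let $\mathcal{T}=\{0,\frac{1}{m-1},\dots,\frac{m-2}{m-1},1\}$ with its natural order. For $a,b\in\mathcal{T}$ put $\sim a=1-a$, $a\rightarrow b=\min\{1,1-a+b\}$, $a\odot b=\max\{0,a+b-1\}$. The language $\mathcal{L}_{\succ}$ has a countable set $\Pi$ of propositional variables, the unary connective $\neg$ and the binary connectives $\rightarrow$ and $\succ$; formulae are built as usual. Abbreviations: $\mathbf{t}:=p\rightarrow p$ (for a fixed variable $p$), $\phi\vee\psi:=(\phi\rightarrow\psi)\rightarrow\psi$, $\phi\wedge\psi:=\neg(\neg\phi\vee\neg\psi)$, $\phi\leftrightarrow\psi:=(\phi\rightarrow\psi)\wedge(\psi\rightarrow\phi)$. For $a\in\mathcal{T}$, $\mathbf{J}_a(\phi)$ is a fixed formula built from $\phi$ with $\neg,\rightarrow$ (the Rosser–Turquette $J$-operator of Łukasiewicz $m$-valued logic) whose value is $1$ if the value of $\phi$ is $a$ and $0$ otherwise; $\mathbf{I}_a(\phi):=\mathbf{J}_a(\phi)\vee\dots\vee\mathbf{J}_1(\phi)$ (disjunction over all $b\in\mathcal{T}$ with $b\ge a$), whose value is $1$ if the value of $\phi$ is $\ge a$ and $0$ otherwise. Iterated implication: $\rightarrow_{i=1}^{0}(\phi_i,\psi):=\psi$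 and $\rightarrow_{i=1}^{k}(\phi_i,\psi):=\phi_k\rightarrow(\rightarrow_{i=1}^{k-1}(\phi_i,\psi))$. A Kripke $\mathbf{LCR}$ model is $\mathfrak{J}=\langle W,\mathcal{A},\{R_X:X\in\mathcal{A}\},\nu\rangle$ with $W$ a nonempty set, $\mathcal{A}\subseteq(\mathcal{P}(W))^m$, each $R_X:W\times W\to\mathcal{T}$ (write $xR_Xy$ for its value), and $\nu:\Pi\times W\to\mathcal{T}$ (write $\nu_x(p)$). It is extended to all formulae by $\nu_x(\neg\phi)=\sim\nu_x(\phi)$, $\nu_x(\phi\rightarrow\psi)=\nu_x(\phi)\rightarrow\nu_x(\psi)$, $\nu_x(\phi\succ\psi)=\bigwedge\{xR_{|\phi|}y\rightarrow\nu_y(\psi):y\in W\}$ (infimum), where $|\phi|=(|\phi|_1,\dots,|\phi|_m)$ with $|\phi|_i=\{x\in W:\nu_x(\phi)=\frac{i-1}{m-1}\}$ (the semantics presupposes $|\phi|\in\mathcal{A}$). For a class $\mathcal{C}$ of such models, $\Sigma\models_{\mathcal{C}}\phi$ means: for every model in $\mathcal{C}$ and every world $w$, if $\nu_w(\psi)=1$ for all $\psi\in\Sigma$ then $\nu_w(\phi)=1$. $\mathcal{C}_K^{\mathbf{LCR}}$ is the class of all Kripke $\mathbf{LCR}$ models. The system $\mathbf{LCR}$: all $\mathcal{L}_{\succ}$-instances of the axioms of a (complete) axiomatization of Łukasiewicz $m$-valued propositional logic $\mathbf{L}$ with modus ponens (MP), plus the axioms A1: $(\phi\succ(\psi\wedge\theta))\rightarrow((\phi\succ\psi)\wedge(\phi\succ\theta))$;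 A2: $((\phi\succ\psi)\wedge(\phi\succ\theta))\rightarrow(\phi\succ(\psi\wedge\theta))$; A3: $\phi\succ\mathbf{t}$; and the rules (RCEA): from $\phi\leftrightarrow\psi$ infer $(\phi\succ\theta)\leftrightarrow(\psi\succ\theta)$; (RCEC): from $\phi\leftrightarrow\psi$ infer $(\theta\succ\phi)\leftrightarrow(\theta\succ\psi)$; $(\mathrm{R}_a)$ for each $a\in\mathcal{T}$: from $\rightarrow_{i=1}^{m}(\mathbf{I}_{a_i\odot b}(\gamma_i),\mathbf{I}_{a\odot b}(\gamma))$ for every $b\in\mathcal{T}$, infer $\rightarrow_{i=1}^{m}(\mathbf{I}_{a_i}(\phi\succ\gamma_i),\mathbf{I}_{a}(\phi\succ\gamma))$, where $a_i=\frac{m-i}{m-1}$. $\vdash_{\mathbf{LCR}}\phi$ means $\phi$ is a theorem of $\mathbf{LCR}$; $\Gamma\vdash_{\mathbf{LCR}}\phi$ means there is a finite sequence ending with $\phi$ each member of which is a theorem of $\mathbf{LCR}$, a member of $\Gamma$, or obtained by MP from earlier members. -}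

module Defs where

open import Data.Nat using (ℕ; zero; suc; _+_; _∸_)
open import Data.Fin using (Fin; zero; suc; toℕ; fromℕ; _≤_)
open import Data.Product using (_×_)
open import Relation.Binary.PropositionalEquality using (_≡_)
open import Relation.Nullary using (¬_)

-- Truth values.  m = suc n (so m ≥ 2 iff n ≥ 1); the element i : Fin (suc n)
-- represents the truth value i/(m-1) = i/n.

TV : ℕ → Set
TV n = Fin (suc n)

clamp : (n k : ℕ) → Fin (suc n)
clamp n       zero    = zero
clamp zero    (suc k) = zero
clamp (suc n) (suc k) = suc (clamp n k)

top : (n : ℕ) → TV n
top n = fromℕ n

bot : (n : ℕ) → TV n
bot n = zero

tneg : (n : ℕ) → TV n → TV n
tneg n a = clamp n (n ∸ toℕ a)

-- a → b = min{1, 1 - a + b}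
timp : (n : ℕ) → TV n → TV n → TV n
timp n a b = clamp n ((n ∸ toℕ a) + toℕ b)

-- a ⊙ b = max{0, a + b - 1}
todot : (n : ℕ) → TV n → TV n → TV n
todot n a b = clamp n ((toℕ a + toℕ b) ∸ n)

IsInf : (n : ℕ) {W : Set} → TV n → (W → TV n) → Set
IsInf n {W} c f = ((y : W) → c ≤ f y) × ((d : TV n) → ((y : W) → d ≤ f y) → d ≤ c)

data LForm : Set where
  lvar : ℕ → LForm
  lneg : LForm → LForm
  limp : LForm → LForm → LForm

evalL : (n : ℕ) → (ℕ → TV n) → LForm → TV n
evalL n e (lvar p)   = e p
evalL n e (lneg ψ)   = tneg n (evalL n e ψ)
evalL n e (limp ψ χ) = timp n (evalL n e ψ) (evalL n e χ)

LTaut : (n : ℕ) → LForm → Set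
LTaut n ψ = (e : ℕ → TV n) → evalL n e ψ ≡ top n

data LDeriv (Ax : LForm → Set) : LForm → Set where
  lax : ∀ {ψ} → Ax ψ → LDeriv Ax ψ
  lmp : ∀ {ψ χ} → LDeriv Ax ψ → LDeriv Ax (limp ψ χ) → LDeriv Ax χ

IsLAxiomatization : (n : ℕ) → (LForm → Set) → Set
IsLAxiomatization n Ax =
  (ψ : LForm) → (LDeriv Ax ψ → LTaut n ψ) × (LTaut n ψ → LDeriv Ax ψ)

IsJOperator : (n : ℕ) → (TV n → LForm) → Set
IsJOperator n j = (a : TV n) (e : ℕ → TV n) →
  (e 0 ≡ a → evalL n e (j a) ≡ top n) × (¬ (e 0 ≡ a) → evalL n e (j a) ≡ bot n)

infixr 5 _⇒_
infix  6 _≻_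

data Form : Set where
  var : ℕ → Form
  ¬'_ : Form → Form
  _⇒_ : Form → Form → Form
  _≻_ : Form → Form → Form

subst : (ℕ → Form) → LForm → Form
subst σ (lvar p)   = σ p
subst σ (lneg ψ)   = ¬' subst σ ψ
subst σ (limp ψ χ) = subst σ ψ ⇒ subst σ χ

𝐭 : Form
𝐭 = var 0 ⇒ var 0

_∨'_ : Form → Form → Form
φ ∨' ψ = (φ ⇒ ψ) ⇒ ψ

_∧'_ : Form → Form → Form
φ ∧' ψ = ¬' ((¬' φ) ∨' (¬' ψ))

_⇔_ : Form → Form → Form
φ ⇔ ψ = (φ ⇒ ψ) ∧' (ψ ⇒ φ)

JOp : (n : ℕ) → (TV n → LForm) → TV n → Form → Form
JOp n j a φ = subst (λ _ → φ) (j a)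

Iaux : (n : ℕ) → (TV n → LForm) → ℕ → ℕ → Form → Form
Iaux n j zero    s φ = JOp n j (clamp n s) φ
Iaux n j (suc c) s φ = JOp n j (clamp n s) φ ∨' Iaux n j c (suc s) φ

IOp : (n : ℕ) → (TV n → LForm) → TV n → Form → Form
IOp n j a φ = Iaux n j (n ∸ toℕ a) (toℕ a) φ

-- iterated implication →_{i=1}^k (f i, ψ)  (f indexed from 1)
iterImp : ℕ → (ℕ → Form) → Form → Form
iterImp zero    f ψ = ψ
iterImp (suc k) f ψ = f (suc k) ⇒ iterImp k f ψ

-- a_i = (m - i)/(m - 1), for i = 1..m (m = suc n)
aIdx : (n : ℕ) → ℕ → TV n
aIdx n i = clamp n (suc n ∸ i)

module LCR (n : ℕ) (Ax : LForm → Set) (j : TV n → LForm) where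

  I : TV n → Form → Form
  I = IOp n j

  data Thm : Form → Set where
    ax   : ∀ {ψ} (σ : ℕ → Form) → Ax ψ → Thm (subst σ ψ)
    mp   : ∀ {φ ψ} → Thm φ → Thm (φ ⇒ ψ) → Thm ψ
    A1   : ∀ φ ψ θ → Thm ((φ ≻ (ψ ∧' θ)) ⇒ ((φ ≻ ψ) ∧' (φ ≻ θ)))
    A2   : ∀ φ ψ θ → Thm (((φ ≻ ψ) ∧' (φ ≻ θ)) ⇒ (φ ≻ (ψ ∧' θ)))
    A3   : ∀ φ → Thm (φ ≻ 𝐭)
    RCEA : ∀ {φ ψ} θ → Thm (φ ⇔ ψ) → Thm ((φ ≻ θ) ⇔ (ψ ≻ θ))
    RCEC : ∀ {φ ψ} θ → Thm (φ ⇔ ψ) → Thm ((θ ≻ φ) ⇔ (θ ≻ ψ))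
    Ra   : (a : TV n) (φ γ : Form) (γs : ℕ → Form) →
           ((b : TV n) →
             Thm (iterImp (suc n) (λ i → I (todot n (aIdx n i) b) (γs i))
                                  (I (todot n a b) γ))) →
           Thm (iterImp (suc n) (λ i → I (aIdx n i) (φ ≻ γs i)) (I a (φ ≻ γ)))

  data _⊢_ (Γ : Form → Set) : Form → Set where
    thm : ∀ {φ} → Thm φ → Γ ⊢ φ
    hyp : ∀ {φ} → Γ φ → Γ ⊢ φ
    mp  : ∀ {φ ψ} → Γ ⊢ φ → Γ ⊢ (φ ⇒ ψ) → Γ ⊢ ψ

-- Subsets of W are predicates W → Set; an element of
-- (P(W))^m is a family Fin m → W → Set.  Besides the primitive data
-- (W, 𝒜, R, ν) a model carries the extension V of ν to all formulae,
-- required to satisfy the defining clauses (V is uniquely determined by them).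

record KripkeModel (n : ℕ) : Set₁ where
  field
    W    : Set
    𝒜    : (Fin (suc n) → W → Set) → Set
    R    : (X : Fin (suc n) → W → Set) → 𝒜 X → W → W → TV n
    R-ext : (X Y : Fin (suc n) → W → Set) (p : 𝒜 X) (q : 𝒜 Y) →
            ((i : Fin (suc n)) (x : W) → (X i x → Y i x) × (Y i x → X i x)) →
            (x y : W) → R X p x y ≡ R Y q x y
    ν    : ℕ → W → TV n
    V    : W → Form → TV n
    V-var : (x : W) (p : ℕ) → V x (var p) ≡ ν p x
    V-neg : (x : W) (φ : Form) → V x (¬' φ) ≡ tneg n (V x φ)
    V-imp : (x : W) (φ ψ : Form) → V x (φ ⇒ ψ) ≡ timp n (V x φ) (V x ψ)
    V-adm : (φ : Form) → 𝒜 (λ i x → V x φ ≡ i)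
    V-cond : (x : W) (φ ψ : Form) →
             IsInf n (V x (φ ≻ ψ))
               (λ y → timp n (R (λ i z → V z φ ≡ i) (V-adm φ) x y) (V y ψ))

_⊨_ : {n : ℕ} → (Form → Set) → Form → Set₁
_⊨_ {n} Γ φ = (𝔐 : KripkeModel n) (w : KripkeModel.W 𝔐) →
  ((ψ : Form) → Γ ψ → KripkeModel.V 𝔐 w ψ ≡ top n) →
  KripkeModel.V 𝔐 w φ ≡ top n

-- Everything reduces to residuation in the
-- finite MV-chain, a ≤ r → g iff a ⊙ r ≤ g, applied to the clause for ≻: the value
-- of φ ≻ ψ at x is the greatest a with a ⊙ xR_|φ|y ≤ ν_y(ψ) for every y.  This gives
-- monotonicity of ≻ in its consequent (A1, RCEC), preservation of meets (A2), A3,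
-- and the rule R_a, whose premises are used at b = xR_|φ|y.  The J- and I-operators
-- take only the values 0 and 1, so iterated implications between them behave
-- classically; RCEA holds because R_X depends only on the truth sets X.
module Submission where

open import Defs
open import Data.Nat using (ℕ; zero; suc; _+_; _∸_; _⊓_; _⊔_; _<_; _≤_; z≤n)
open import Data.Nat.Properties
open import Data.Fin using (Fin; toℕ) renaming (_≤_ to _≤ᶠ_)
import Data.Fin.Properties as Fin
open import Data.Product using (_×_; _,_; proj₁; proj₂)
open import Data.Sum using (_⊎_; inj₁; inj₂)
open import Relation.Nullary using (¬_; yes; no)
open import Function using (_∘_)
open import Relation.Binary.PropositionalEquality using (_≡_; refl; sym; trans; cong; cong₂; module ≡-Reasoning)

toℕ-clamp : (n k : ℕ) → toℕ (clamp n k) ≡ k ⊓ n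
toℕ-clamp n       zero    = refl
toℕ-clamp zero    (suc k) = refl
toℕ-clamp (suc n) (suc k) = cong suc (toℕ-clamp n k)

toℕ-clamp-≤ : {n k : ℕ} → k ≤ n → toℕ (clamp n k) ≡ k
toℕ-clamp-≤ {n} {k} k≤n = trans (toℕ-clamp n k) (m≤n⇒m⊓n≡m k≤n)

m∸n+o+n≡m+o : {n r : ℕ} (g : ℕ) → r ≤ n → n ∸ r + g + r ≡ n + g
m∸n+o+n≡m+o {n} {r} g r≤n = begin
  n ∸ r + g + r    ≡⟨ +-assoc (n ∸ r) g r ⟩
  n ∸ r + (g + r)  ≡⟨ cong (n ∸ r +_) (+-comm g r) ⟩
  n ∸ r + (r + g)  ≡⟨ sym (+-assoc (n ∸ r) r g) ⟩
  n ∸ r + r + g    ≡⟨ cong (_+ g) (m∸n+n≡m r≤n) ⟩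
  n + g            ∎
  where open ≡-Reasoning

module TruthValues (n : ℕ) where

  tor : TV n → TV n → TV n
  tor a b = timp n (timp n a b) b

  tand : TV n → TV n → TV n
  tand a b = tneg n (tor (tneg n a) (tneg n b))

  Crisp : TV n → Set
  Crisp a = a ≡ top n ⊎ a ≡ bot n

  toℕ≤n : (a : TV n) → toℕ a ≤ n
  toℕ≤n = Fin.toℕ≤pred[n]

  toℕ-top : toℕ (top n) ≡ n
  toℕ-top = Fin.toℕ-fromℕ n

  top≤⇒≡top : {a : TV n} → top n ≤ᶠ a → a ≡ top n
  top≤⇒≡top top≤a = Fin.≤-antisym (Fin.≤fromℕ _) top≤a

  toℕ-tneg : (a : TV n) → toℕ (tneg n a) ≡ n ∸ toℕ a
  toℕ-tneg a = toℕ-clamp-≤ (m∸n≤m n (toℕ a))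

  toℕ-timp : (a b : TV n) → toℕ (timp n a b) ≡ (n ∸ toℕ a + toℕ b) ⊓ n
  toℕ-timp a b = toℕ-clamp n _

  toℕ-todot : (a b : TV n) → toℕ (todot n a b) ≡ toℕ a + toℕ b ∸ n
  toℕ-todot a b = toℕ-clamp-≤ (begin
    toℕ a + toℕ b ∸ n  ≤⟨ ∸-monoˡ-≤ n (+-monoʳ-≤ (toℕ a) (toℕ≤n b)) ⟩
    toℕ a + n ∸ n      ≡⟨ m+n∸n≡m (toℕ a) n ⟩
    toℕ a              ≤⟨ toℕ≤n a ⟩
    n                  ∎)
    where open ≤-Reasoning

  ≤-timp⇒todot-≤ : {a r g : TV n} → a ≤ᶠ timp n r g → todot n a r ≤ᶠ g
  ≤-timp⇒todot-≤ {a} {r} {g} a≤r⇒g = begin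
    toℕ (todot n a r)      ≡⟨ toℕ-todot a r ⟩
    toℕ a + toℕ r ∸ n      ≤⟨ m≤n+o⇒m∸n≤o (toℕ a + toℕ r) n (begin
      toℕ a + toℕ r                  ≤⟨ +-monoˡ-≤ (toℕ r) a≤ ⟩
      n ∸ toℕ r + toℕ g + toℕ r      ≡⟨ m∸n+o+n≡m+o (toℕ g) (toℕ≤n r) ⟩
      n + toℕ g                      ∎) ⟩
    toℕ g                  ∎
    where
      open ≤-Reasoning
      a≤ : toℕ a ≤ n ∸ toℕ r + toℕ g
      a≤ = ≤-trans a≤r⇒g (≤-trans (≤-reflexive (toℕ-timp r g)) (m⊓n≤m _ n))

  todot-≤⇒≤-timp : {a r g : TV n} → todot n a r ≤ᶠ g → a ≤ᶠ timp n r g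
  todot-≤⇒≤-timp {a} {r} {g} ar≤g = ≤-trans (⊓-glb a≤ (toℕ≤n a)) (≤-reflexive (sym (toℕ-timp r g)))
    where
      open ≤-Reasoning
      a≤ : toℕ a ≤ n ∸ toℕ r + toℕ g
      a≤ = +-cancelʳ-≤ (toℕ r) (toℕ a) _ (begin
        toℕ a + toℕ r                    ≤⟨ m≤n+m∸n (toℕ a + toℕ r) n ⟩
        n + (toℕ a + toℕ r ∸ n)          ≡⟨ cong (n +_) (sym (toℕ-todot a r)) ⟩
        n + toℕ (todot n a r)            ≤⟨ +-monoʳ-≤ n ar≤g ⟩
        n + toℕ g                        ≡⟨ sym (m∸n+o+n≡m+o (toℕ g) (toℕ≤n r)) ⟩
        n ∸ toℕ r + toℕ g + toℕ r        ∎)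

  todot-top : (a : TV n) → todot n (top n) a ≡ a
  todot-top a = Fin.toℕ-injective (begin
    toℕ (todot n (top n) a)  ≡⟨ toℕ-todot (top n) a ⟩
    toℕ (top n) + toℕ a ∸ n  ≡⟨ cong (λ t → t + toℕ a ∸ n) toℕ-top ⟩
    n + toℕ a ∸ n            ≡⟨ m+n∸m≡n n (toℕ a) ⟩
    toℕ a                    ∎)
    where open ≡-Reasoning

  timp≡top⇒≤ : {a b : TV n} → timp n a b ≡ top n → a ≤ᶠ b
  timp≡top⇒≤ {a} {b} eq = Fin.≤-trans (Fin.≤-reflexive (sym (todot-top a)))
    (≤-timp⇒todot-≤ (Fin.≤-reflexive (sym eq)))

  ≤⇒timp≡top : {a b : TV n} → a ≤ᶠ b → timp n a b ≡ top n
  ≤⇒timp≡top {a} a≤b = top≤⇒≡top (todot-≤⇒≤-timp (Fin.≤-trans (Fin.≤-reflexive (todot-top a)) a≤b))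

  toℕ-timp-≥ : {a b : TV n} → toℕ b ≤ toℕ a → toℕ (timp n a b) ≡ n ∸ toℕ a + toℕ b
  toℕ-timp-≥ {a} {b} b≤a = toℕ-clamp-≤ (begin
    n ∸ toℕ a + toℕ b  ≤⟨ +-monoʳ-≤ (n ∸ toℕ a) b≤a ⟩
    n ∸ toℕ a + toℕ a  ≡⟨ m∸n+n≡m (toℕ≤n a) ⟩
    n                  ∎)
    where open ≤-Reasoning

  toℕ-tor : (a b : TV n) → toℕ (tor a b) ≡ toℕ a ⊔ toℕ b
  toℕ-tor a b with ≤-total (toℕ a) (toℕ b)
  ... | inj₁ a≤b = begin
    toℕ (timp n (timp n a b) b)          ≡⟨ cong (λ c → toℕ (timp n c b)) (≤⇒timp≡top a≤b) ⟩
    toℕ (timp n (top n) b)               ≡⟨ toℕ-timp (top n) b ⟩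
    (n ∸ toℕ (top n) + toℕ b) ⊓ n        ≡⟨ cong (λ t → (n ∸ t + toℕ b) ⊓ n) toℕ-top ⟩
    (n ∸ n + toℕ b) ⊓ n                  ≡⟨ cong (λ t → (t + toℕ b) ⊓ n) (n∸n≡0 n) ⟩
    toℕ b ⊓ n                            ≡⟨ m≤n⇒m⊓n≡m (toℕ≤n b) ⟩
    toℕ b                                ≡⟨ sym (m≤n⇒m⊔n≡n a≤b) ⟩
    toℕ a ⊔ toℕ b                        ∎
    where open ≡-Reasoning
  ... | inj₂ b≤a = begin
    toℕ (timp n (timp n a b) b)                ≡⟨ toℕ-timp (timp n a b) b ⟩
    (n ∸ toℕ (timp n a b) + toℕ b) ⊓ n         ≡⟨ cong (λ t → (n ∸ t + toℕ b) ⊓ n) (toℕ-timp-≥ b≤a) ⟩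
    (n ∸ (n ∸ toℕ a + toℕ b) + toℕ b) ⊓ n      ≡⟨ cong (λ t → (t + toℕ b) ⊓ n) (sym (∸-+-assoc n (n ∸ toℕ a) (toℕ b))) ⟩
    (n ∸ (n ∸ toℕ a) ∸ toℕ b + toℕ b) ⊓ n      ≡⟨ cong (λ t → (t ∸ toℕ b + toℕ b) ⊓ n) (m∸[m∸n]≡n (toℕ≤n a)) ⟩
    (toℕ a ∸ toℕ b + toℕ b) ⊓ n                ≡⟨ cong (_⊓ n) (m∸n+n≡m b≤a) ⟩
    toℕ a ⊓ n                                  ≡⟨ m≤n⇒m⊓n≡m (toℕ≤n a) ⟩
    toℕ a                                      ≡⟨ sym (m≥n⇒m⊔n≡m b≤a) ⟩
    toℕ a ⊔ toℕ b                              ∎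
    where open ≡-Reasoning

  toℕ-tand : (a b : TV n) → toℕ (tand a b) ≡ toℕ a ⊓ toℕ b
  toℕ-tand a b = begin
    toℕ (tneg n (tor (tneg n a) (tneg n b)))              ≡⟨ toℕ-tneg (tor (tneg n a) (tneg n b)) ⟩
    n ∸ toℕ (tor (tneg n a) (tneg n b))                   ≡⟨ cong (n ∸_) (toℕ-tor (tneg n a) (tneg n b)) ⟩
    n ∸ (toℕ (tneg n a) ⊔ toℕ (tneg n b))                 ≡⟨ cong₂ (λ s t → n ∸ (s ⊔ t)) (toℕ-tneg a) (toℕ-tneg b) ⟩
    n ∸ ((n ∸ toℕ a) ⊔ (n ∸ toℕ b))                       ≡⟨ ∸-distribˡ-⊔-⊓ n (n ∸ toℕ a) (n ∸ toℕ b) ⟩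
    (n ∸ (n ∸ toℕ a)) ⊓ (n ∸ (n ∸ toℕ b))                 ≡⟨ cong₂ _⊓_ (m∸[m∸n]≡n (toℕ≤n a)) (m∸[m∸n]≡n (toℕ≤n b)) ⟩
    toℕ a ⊓ toℕ b                                         ∎
    where open ≡-Reasoning

  tand-≤ˡ : (a b : TV n) → tand a b ≤ᶠ a
  tand-≤ˡ a b = ≤-trans (≤-reflexive (toℕ-tand a b)) (m⊓n≤m (toℕ a) (toℕ b))

  tand-≤ʳ : (a b : TV n) → tand a b ≤ᶠ b
  tand-≤ʳ a b = ≤-trans (≤-reflexive (toℕ-tand a b)) (m⊓n≤n (toℕ a) (toℕ b))

  ≤-tand : {a b c : TV n} → c ≤ᶠ a → c ≤ᶠ b → c ≤ᶠ tand a b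
  ≤-tand {a} {b} c≤a c≤b = ≤-trans (⊓-glb c≤a c≤b) (≤-reflexive (sym (toℕ-tand a b)))

  ≤-torˡ : (a b : TV n) → a ≤ᶠ tor a b
  ≤-torˡ a b = ≤-trans (m≤m⊔n (toℕ a) (toℕ b)) (≤-reflexive (sym (toℕ-tor a b)))

  ≤-torʳ : (a b : TV n) → b ≤ᶠ tor a b
  ≤-torʳ a b = ≤-trans (m≤n⊔m (toℕ a) (toℕ b)) (≤-reflexive (sym (toℕ-tor a b)))

  ≡top-≤ : {a b : TV n} → a ≡ top n → a ≤ᶠ b → b ≡ top n
  ≡top-≤ refl = top≤⇒≡top

  tand≡top⇒ : {a b : TV n} → tand a b ≡ top n → a ≡ top n × b ≡ top n
  tand≡top⇒ {a} {b} eq = ≡top-≤ eq (tand-≤ˡ a b) , ≡top-≤ eq (tand-≤ʳ a b)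

  tand-top : tand (top n) (top n) ≡ top n
  tand-top = top≤⇒≡top (≤-tand ≤-refl ≤-refl)

  tor-bot : tor (bot n) (bot n) ≡ bot n
  tor-bot = Fin.toℕ-injective (toℕ-tor (bot n) (bot n))

  IsInf-unique : {W : Set} {c d : TV n} {f g : W → TV n} → (∀ y → f y ≡ g y) →
                 IsInf n c f → IsInf n d g → c ≡ d
  IsInf-unique f≗g (c≤f , c-greatest) (d≤g , d-greatest) = Fin.≤-antisym
    (d-greatest _ (λ y → Fin.≤-trans (c≤f y) (Fin.≤-reflexive (f≗g y))))
    (c-greatest _ (λ y → Fin.≤-trans (d≤g y) (Fin.≤-reflexive (sym (f≗g y)))))

module Semantics {n : ℕ} (M : KripkeModel n) where
  open KripkeModel M
  open TruthValues n

  R[_] : Form → W → W → TV n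
  R[ φ ] = R (λ i z → V z φ ≡ i) (V-adm φ)

  V-∨ : (x : W) (φ ψ : Form) → V x (φ ∨' ψ) ≡ tor (V x φ) (V x ψ)
  V-∨ x φ ψ = trans (V-imp x (φ ⇒ ψ) ψ) (cong (λ c → timp n c (V x ψ)) (V-imp x φ ψ))

  V-∧ : (x : W) (φ ψ : Form) → V x (φ ∧' ψ) ≡ tand (V x φ) (V x ψ)
  V-∧ x φ ψ = trans (V-neg x _)
    (cong (tneg n) (trans (V-∨ x (¬' φ) (¬' ψ)) (cong₂ tor (V-neg x φ) (V-neg x ψ))))

  V-subst : (x : W) (σ : ℕ → Form) (ψ : LForm) → V x (subst σ ψ) ≡ evalL n (λ p → V x (σ p)) ψ
  V-subst x σ (lvar p)   = refl
  V-subst x σ (lneg ψ)   = trans (V-neg x _) (cong (tneg n) (V-subst x σ ψ))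
  V-subst x σ (limp ψ χ) = trans (V-imp x _ _) (cong₂ (timp n) (V-subst x σ ψ) (V-subst x σ χ))

  ⇒-true⇒≤ : {x : W} {φ ψ : Form} → V x (φ ⇒ ψ) ≡ top n → V x φ ≤ᶠ V x ψ
  ⇒-true⇒≤ {x} {φ} {ψ} eq = timp≡top⇒≤ (trans (sym (V-imp x φ ψ)) eq)

  ≤⇒⇒-true : {x : W} {φ ψ : Form} → V x φ ≤ᶠ V x ψ → V x (φ ⇒ ψ) ≡ top n
  ≤⇒⇒-true {x} {φ} {ψ} le = trans (V-imp x φ ψ) (≤⇒timp≡top le)

  ∧-≤ˡ : {x : W} {φ ψ : Form} → V x (φ ∧' ψ) ≤ᶠ V x φ
  ∧-≤ˡ {x} {φ} {ψ} = Fin.≤-trans (Fin.≤-reflexive (V-∧ x φ ψ)) (tand-≤ˡ (V x φ) (V x ψ))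

  ∧-≤ʳ : {x : W} {φ ψ : Form} → V x (φ ∧' ψ) ≤ᶠ V x ψ
  ∧-≤ʳ {x} {φ} {ψ} = Fin.≤-trans (Fin.≤-reflexive (V-∧ x φ ψ)) (tand-≤ʳ (V x φ) (V x ψ))

  ≤-∧ : {x : W} {φ ψ : Form} {a : TV n} → a ≤ᶠ V x φ → a ≤ᶠ V x ψ → a ≤ᶠ V x (φ ∧' ψ)
  ≤-∧ {x} {φ} {ψ} a≤φ a≤ψ = Fin.≤-trans (≤-tand a≤φ a≤ψ) (Fin.≤-reflexive (sym (V-∧ x φ ψ)))

  ∨-trueˡ : {x : W} {φ ψ : Form} → V x φ ≡ top n → V x (φ ∨' ψ) ≡ top n
  ∨-trueˡ {x} {φ} {ψ} φ-true = ≡top-≤ φ-true (Fin.≤-trans (≤-torˡ (V x φ) (V x ψ)) (Fin.≤-reflexive (sym (V-∨ x φ ψ))))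

  ∨-trueʳ : {x : W} {φ ψ : Form} → V x ψ ≡ top n → V x (φ ∨' ψ) ≡ top n
  ∨-trueʳ {x} {φ} {ψ} ψ-true = ≡top-≤ ψ-true (Fin.≤-trans (≤-torʳ (V x φ) (V x ψ)) (Fin.≤-reflexive (sym (V-∨ x φ ψ))))

  mp-true : {x : W} {φ ψ : Form} → V x φ ≡ top n → V x (φ ⇒ ψ) ≡ top n → V x ψ ≡ top n
  mp-true φ-true φ⇒ψ-true = ≡top-≤ φ-true (⇒-true⇒≤ φ⇒ψ-true)

  ⇔-true⇒≡ : {x : W} {φ ψ : Form} → V x (φ ⇔ ψ) ≡ top n → V x φ ≡ V x ψ
  ⇔-true⇒≡ {x} {φ} {ψ} eq with tand≡top⇒ (trans (sym (V-∧ x (φ ⇒ ψ) (ψ ⇒ φ))) eq)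
  ... | φ⇒ψ , ψ⇒φ = Fin.≤-antisym (⇒-true⇒≤ φ⇒ψ) (⇒-true⇒≤ ψ⇒φ)

  ≡⇒⇔-true : {x : W} {φ ψ : Form} → V x φ ≡ V x ψ → V x (φ ⇔ ψ) ≡ top n
  ≡⇒⇔-true {x} {φ} {ψ} eq = begin
    V x (φ ⇔ ψ)                          ≡⟨ V-∧ x (φ ⇒ ψ) (ψ ⇒ φ) ⟩
    tand (V x (φ ⇒ ψ)) (V x (ψ ⇒ φ))     ≡⟨ cong₂ tand (≤⇒⇒-true (Fin.≤-reflexive eq))
                                                      (≤⇒⇒-true (Fin.≤-reflexive (sym eq))) ⟩
    tand (top n) (top n)                 ≡⟨ tand-top ⟩
    top n                                ∎
    where open ≡-Reasoning

  ≻-residual : {x : W} {φ ψ : Form} {a : TV n} → a ≤ᶠ V x (φ ≻ ψ) →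
               (y : W) → todot n a (R[ φ ] x y) ≤ᶠ V y ψ
  ≻-residual {x} {φ} {ψ} a≤ y = ≤-timp⇒todot-≤ (Fin.≤-trans a≤ (proj₁ (V-cond x φ ψ) y))

  ≤-≻ : {x : W} {φ ψ : Form} {a : TV n} →
        ((y : W) → todot n a (R[ φ ] x y) ≤ᶠ V y ψ) → a ≤ᶠ V x (φ ≻ ψ)
  ≤-≻ {x} {φ} {ψ} {a} H = proj₂ (V-cond x φ ψ) a (λ y → todot-≤⇒≤-timp (H y))

  ≻-monoʳ : {x : W} {φ ψ χ : Form} → ((y : W) → V y ψ ≤ᶠ V y χ) → V x (φ ≻ ψ) ≤ᶠ V x (φ ≻ χ)
  ≻-monoʳ ψ≤χ = ≤-≻ (λ y → Fin.≤-trans (≻-residual Fin.≤-refl y) (ψ≤χ y))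

  ≻-congʳ : {x : W} {φ ψ χ : Form} → ((y : W) → V y ψ ≡ V y χ) → V x (φ ≻ ψ) ≡ V x (φ ≻ χ)
  ≻-congʳ ψ≗χ = Fin.≤-antisym (≻-monoʳ (λ y → Fin.≤-reflexive (ψ≗χ y)))
                              (≻-monoʳ (λ y → Fin.≤-reflexive (sym (ψ≗χ y))))

  ≻-congˡ : {x : W} {φ ψ χ : Form} → ((y : W) → V y φ ≡ V y ψ) → V x (φ ≻ χ) ≡ V x (ψ ≻ χ)
  ≻-congˡ {x} {φ} {ψ} {χ} φ≗ψ = IsInf-unique
    (λ y → cong (λ r → timp n r (V y χ)) (R-ext _ _ (V-adm φ) (V-adm ψ) same-sets x y))
    (V-cond x φ χ) (V-cond x ψ χ)
    where
      same-sets : (i : Fin (suc n)) (z : W) → (V z φ ≡ i → V z ψ ≡ i) × (V z ψ ≡ i → V z φ ≡ i)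
      same-sets i z = trans (sym (φ≗ψ z)) , trans (φ≗ψ z)

  iterImp-elim : {x : W} (k : ℕ) (f : ℕ → Form) (ψ : Form) → V x (iterImp k f ψ) ≡ top n →
                 ((i : ℕ) → i < k → V x (f (suc i)) ≡ top n) → V x ψ ≡ top n
  iterImp-elim zero    f ψ true _ = true
  iterImp-elim (suc k) f ψ true fs = iterImp-elim k f ψ (mp-true (fs k (n<1+n k)) true)
                                                   (λ i i<k → fs i (m<n⇒m<1+n i<k))

  iterImp-intro : {x : W} (k : ℕ) (f : ℕ → Form) (ψ : Form) → ((i : ℕ) → Crisp (V x (f i))) →
                  (((i : ℕ) → i < k → V x (f (suc i)) ≡ top n) → V x ψ ≡ top n) →
                  V x (iterImp k f ψ) ≡ top n
  iterImp-intro zero    f ψ crisp H = H (λ _ ())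
  iterImp-intro {x} (suc k) f ψ crisp H with crisp (suc k)
  ... | inj₂ f≡bot = ≤⇒⇒-true (Fin.≤-trans (Fin.≤-reflexive f≡bot) z≤n)
  ... | inj₁ f≡top = ≤⇒⇒-true (Fin.≤-trans (Fin.≤-reflexive f≡top) (Fin.≤-reflexive (sym rest)))
    where
      extend : ((i : ℕ) → i < k → V x (f (suc i)) ≡ top n) →
               (i : ℕ) → i < suc k → V x (f (suc i)) ≡ top n
      extend fs i i<1+k with m<1+n⇒m<n∨m≡n i<1+k
      ... | inj₁ i<k  = fs i i<k
      ... | inj₂ refl = f≡top

      rest : V x (iterImp k f ψ) ≡ top n
      rest = iterImp-intro k f ψ crisp (λ fs → H (extend fs))

module Operators {n : ℕ} (M : KripkeModel n) (j : TV n → LForm) (isJ : IsJOperator n j) where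
  open KripkeModel M
  open TruthValues n
  open Semantics M

  J-true : {x : W} {φ : Form} {a : TV n} → V x φ ≡ a → V x (JOp n j a φ) ≡ top n
  J-true {x} {φ} {a} eq = trans (V-subst x (λ _ → φ) (j a)) (proj₁ (isJ a (λ _ → V x φ)) eq)

  J-false : {x : W} {φ : Form} {a : TV n} → ¬ V x φ ≡ a → V x (JOp n j a φ) ≡ bot n
  J-false {x} {φ} {a} neq = trans (V-subst x (λ _ → φ) (j a)) (proj₂ (isJ a (λ _ → V x φ)) neq)

  ≡clamp : {a : TV n} {s : ℕ} → s ≤ n → toℕ a ≡ s → a ≡ clamp n s
  ≡clamp s≤n eq = Fin.toℕ-injective (trans eq (sym (toℕ-clamp-≤ s≤n)))

  ≢clamp : {a : TV n} {s : ℕ} → s ≤ n → toℕ a < s → ¬ a ≡ clamp n s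
  ≢clamp s≤n a<s eq = <⇒≢ a<s (trans (cong toℕ eq) (toℕ-clamp-≤ s≤n))

  Iaux-true : {x : W} {φ : Form} (c s : ℕ) → s ≤ toℕ (V x φ) → toℕ (V x φ) ≤ s + c → s + c ≤ n →
              V x (Iaux n j c s φ) ≡ top n
  Iaux-true zero s s≤v v≤s+0 s+0≤n =
    J-true (≡clamp (m+n≤o⇒m≤o s s+0≤n) (≤-antisym (≤-trans v≤s+0 (≤-reflexive (+-identityʳ s))) s≤v))
  Iaux-true {x} {φ} (suc c) s s≤v v≤s+1+c s+1+c≤n with toℕ (V x φ) ≟ s
  ... | yes v≡s = ∨-trueˡ (J-true (≡clamp (m+n≤o⇒m≤o s s+1+c≤n) v≡s))
  ... | no  v≢s = ∨-trueʳ (Iaux-true c (suc s) (≤∧≢⇒< s≤v (v≢s ∘ sym))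
                                   (≤-trans v≤s+1+c (≤-reflexive (+-suc s c)))
                                   (≤-trans (≤-reflexive (sym (+-suc s c))) s+1+c≤n))

  Iaux-false : {x : W} {φ : Form} (c s : ℕ) → toℕ (V x φ) < s → s + c ≤ n →
               V x (Iaux n j c s φ) ≡ bot n
  Iaux-false zero s v<s s+0≤n = J-false (≢clamp (m+n≤o⇒m≤o s s+0≤n) v<s)
  Iaux-false {x} {φ} (suc c) s v<s s+1+c≤n = begin
    V x (Iaux n j (suc c) s φ)                                        ≡⟨ V-∨ x _ _ ⟩
    tor (V x (JOp n j (clamp n s) φ)) (V x (Iaux n j c (suc s) φ))   ≡⟨ cong₂ tor J≡bot Iaux≡bot ⟩
    tor (bot n) (bot n)                                               ≡⟨ tor-bot ⟩
    bot n                                                             ∎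
    where
      open ≡-Reasoning
      J≡bot = J-false (≢clamp (m+n≤o⇒m≤o s s+1+c≤n) v<s)
      Iaux≡bot = Iaux-false c (suc s) (m<n⇒m<1+n v<s) (≤-trans (≤-reflexive (sym (+-suc s c))) s+1+c≤n)

  ≤⇒I-true : {x : W} {φ : Form} {a : TV n} → a ≤ᶠ V x φ → V x (IOp n j a φ) ≡ top n
  ≤⇒I-true {x} {φ} {a} a≤v = Iaux-true (n ∸ toℕ a) (toℕ a) a≤v
    (≤-trans (toℕ≤n (V x φ)) (≤-reflexive (sym a+[n∸a]≡n))) (≤-reflexive a+[n∸a]≡n)
    where a+[n∸a]≡n = m+[n∸m]≡n (toℕ≤n a)

  <⇒I-false : {x : W} {φ : Form} {a : TV n} → toℕ (V x φ) < toℕ a → V x (IOp n j a φ) ≡ bot n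
  <⇒I-false {a = a} v<a = Iaux-false (n ∸ toℕ a) (toℕ a) v<a (≤-reflexive (m+[n∸m]≡n (toℕ≤n a)))

  I-crisp : {x : W} {φ : Form} {a : TV n} → Crisp (V x (IOp n j a φ))
  I-crisp {x} {φ} {a} with toℕ a ≤? toℕ (V x φ)
  ... | yes a≤v = inj₁ (≤⇒I-true a≤v)
  ... | no  a≰v = inj₂ (<⇒I-false (≰⇒> a≰v))

  -- For m = 1 (n = 0) the I-operator cannot separate, but then every truth value is 0.
  I-true⇒≤ : {x : W} {φ : Form} {a : TV n} → V x (IOp n j a φ) ≡ top n → a ≤ᶠ V x φ
  I-true⇒≤ {x} {φ} {a} I-true with toℕ a ≤? toℕ (V x φ)
  ... | yes a≤v = a≤v
  ... | no  a≰v = ≤-trans (toℕ≤n a) (≤-trans (≤-reflexive n≡0) z≤n)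
    where
      n≡0 : n ≡ 0
      n≡0 = trans (sym toℕ-top) (cong toℕ (trans (sym I-true) (<⇒I-false (≰⇒> a≰v))))

module Soundness {n : ℕ} (Ax : LForm → Set) (Ax-sound : {ψ : LForm} → Ax ψ → LTaut n ψ)
                 (j : TV n → LForm) (isJ : IsJOperator n j) (M : KripkeModel n) where
  open KripkeModel M
  open TruthValues n
  open Semantics M
  open Operators M j isJ
  open LCR n Ax j

  Ra-sound : (a : TV n) (φ γ : Form) (γs : ℕ → Form) →
             ((b : TV n) (y : W) →
               V y (iterImp (suc n) (λ i → I (todot n (aIdx n i) b) (γs i)) (I (todot n a b) γ)) ≡ top n) →
             (x : W) → V x (iterImp (suc n) (λ i → I (aIdx n i) (φ ≻ γs i)) (I a (φ ≻ γ))) ≡ top n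
  Ra-sound a φ γ γs premise x = iterImp-intro (suc n) _ _ (λ i → I-crisp {a = aIdx n i})
    (λ antecedents → ≤⇒I-true (≤-≻ (λ y → I-true⇒≤
      (iterImp-elim (suc n) _ _ (premise (R[ φ ] x y) y)
        (λ i i≤n → ≤⇒I-true (≻-residual (I-true⇒≤ (antecedents i i≤n)) y))))))

  valid : {φ : Form} → Thm φ → (x : W) → V x φ ≡ top n
  valid (ax {ψ} σ a) x = trans (V-subst x σ ψ) (Ax-sound a _)
  valid (mp d e)     x = mp-true (valid d x) (valid e x)
  valid (A1 φ ψ θ)   x = ≤⇒⇒-true (≤-∧ (≻-monoʳ (λ _ → ∧-≤ˡ)) (≻-monoʳ (λ _ → ∧-≤ʳ)))
  valid (A2 φ ψ θ)   x = ≤⇒⇒-true (≤-≻ (λ y → ≤-∧ (≻-residual ∧-≤ˡ y) (≻-residual ∧-≤ʳ y)))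
  valid (A3 φ)       x = top≤⇒≡top (≤-≻ (λ y → Fin.≤-trans (Fin.≤fromℕ _)
                                                  (Fin.≤-reflexive (sym (≤⇒⇒-true Fin.≤-refl)))))
  valid (RCEA θ d)   x = ≡⇒⇔-true (≻-congˡ (λ y → ⇔-true⇒≡ (valid d y)))
  valid (RCEC θ d)   x = ≡⇒⇔-true (≻-congʳ (λ y → ⇔-true⇒≡ (valid d y)))
  valid (Ra a φ γ γs prem) x = Ra-sound a φ γ γs (λ b → valid (prem b)) x

  ⊢-sound : {Γ : Form → Set} {φ : Form} → Γ ⊢ φ → (w : W) →
            ((ψ : Form) → Γ ψ → V w ψ ≡ top n) → V w φ ≡ top n
  ⊢-sound (thm t)       w Γ-true = valid t w
  ⊢-sound (hyp {ψ} γ)   w Γ-true = Γ-true ψ γ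
  ⊢-sound (mp d e)      w Γ-true = mp-true (⊢-sound d w Γ-true) (⊢-sound e w Γ-true)

theorem2p10 : (n : ℕ) → 1 ≤ n → (Ax : LForm → Set) → IsLAxiomatization n Ax → (j : TV n → LForm) → IsJOperator n j → (Γ : Form → Set) (φ : Form) → LCR._⊢_ n Ax j Γ φ → _⊨_ {n} Γ φ
theorem2p10 n _ Ax isAx j isJ Γ φ d M =
  Soundness.⊢-sound Ax (λ a → proj₁ (isAx _) (lax a)) j isJ M d
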